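{- Let $\mathcal{R}$ be a finite set of rules, $G$ an attributed graph and $M\subseteq\mathrm{Match}_{\mathcal{R}}(G)$. If $M$ is parallel coherent then $M$ has the effective deletion property.
   Context: Fix a many-sorted signature $\Sigma$ and a set $\mathscr{V}$ of sorted variables disjoint from $\Sigma$; $T_\Sigma(X)$ is the term algebra over a finite $X\subseteq\mathscr{V}$, and $|\mathcal{A}|$ denotes the disjoint union of the carriers of a $\Sigma$-algebra $\mathcal{A}$. An attributed graph $G=(V_G,A_G,s_G,t_G,\mathcal{A}_G,l_G)$ consists of sets $V_G$ (vertices) and $A_G$ (arrows), source and target functions $s_G,t_G:A_G\to V_G$, a $\Sigma$-algebra $\mathcal{A}_G$, and an attribution $l_G:V_G\cup A_G\to\mathcal{P}(|\mathcal{A}_G|)$, with $V_G,A_G,|\mathcal{A}_G|$ pairwise disjoint. $H\lhd G$ ($H$ is a subgraph of $G$) if $V_H\subseteq V_G$, $A_H\subseteq A_G$, $s_H,t_H$ are restrictions of $s_G,t_G$, $\mathcal{A}_H=\mathcal{A}_G$, and $l_H(x)\subseteq l_G(x)$ for all $x\in V_H\cup A_H$. A morphism $\alpha:H\to G$ is a function from $V_H\cup A_H\cup|\mathcal{A}_H|$ to $V_G\cup A_G\cup|\mathcal{A}_G|$ mapping vertices to vertices and arrows to arrows with $s_G\circ\alpha=\alpha\circ s_H$, $t_G\circ\alpha=\alpha\circ t_H$, whose restriction $\alpha_{\mathcal{A}}$ to $|\mathcal{A}_H|$ is a $\Sigma$-homomorphism into $\mathcal{A}_G$, and with $\alpha_{\mathcal{A}}(l_H(x))\subseteq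 l_G(\alpha(x))$. For $F\lhd H$, $\alpha(F)$ is the smallest subgraph of $G$ such that $\alpha$ restricted to $F$ is a morphism $F\to\alpha(F)$. A matching is a morphism injective on vertices and arrows. Attributions are combined pointwise, an attribution of a subgraph being extended by $\varnothing$. Graphs $H,G$ are joinable if $\mathcal{A}_H=\mathcal{A}_G$, $V_H\cap A_G=A_H\cap V_G=\varnothing$, and $s_H,s_G$ (resp. $t_H,t_G$) agree on $A_H\cap A_G$; then $H\sqcap G$ has vertices $V_H\cap V_G$, arrows $A_H\cap A_G$, the common source/target maps, algebra $\mathcal{A}_H$ and attribution $l_H\cap l_G$, and $H\sqcup G$ has vertices $V_H\cup V_G$, arrows $A_H\cup A_G$, the joined source/target maps, algebra $\mathcal{A}_H$ and attribution $l_H\cup l_G$; $\bigsqcup_{i}G_i$ is defined likewise for pairwise joinable families with a common algebra. $G$ is disjoint from $V,A,l$ ($V,A$ sets, $l$ an attribution) if $V_G\cap V=\varnothing$, $A_G\cap A=\varnothing$ and $l_G(x)\cap l(x)=\varnothing$ for all $x\in V_G\cup A_G$; $G\setminus(V,A,l)$ denotes the largest subgraph of $G$ disjoint from $V,A,l$. A $(\Sigma,X)$-graph is a finite graph with algebra $T_\Sigma(X)$. A rule is a triple $r=(L,K,R)$ of $(\Sigma,X)$-graphs with $L,R$ joinable, $L\sqcap R\lhd K\lhd L$, and $X$ equal to the set of variables occurring in attributes of $L$. A matching of $r$ in $G$ is a matching $\mu:L\to G$ that is consistent: $\mu_{\mathcal{A}}(l_L(x)\setminus l_K(x))\cap\mu_{\mathcal{A}}(l_K(x))=\varnothing$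 for all $x\in V_K\cup A_K$. $\mathcal{R}$ is a finite set of rules whose distinct members have distinct left-hand-side carriers; $\mathrm{Match}_{\mathcal{R}}(G)$ is the (disjoint) union of the sets of matchings of its rules in $G$, and for $\mu\in\mathrm{Match}_{\mathcal{R}}(G)$ its rule is written $(L_\mu,K_\mu,R_\mu)$. For such $\mu$ define $\mu^{\uparrow}$ on $R_\mu$: it equals $\mu_{\mathcal{A}}$ on the algebra, $\mu^{\uparrow}(x)=\mu(x)$ if $x\in V_{K_\mu}\cup A_{K_\mu}$, and $\mu^{\uparrow}(x)=(x,\mu)$ (a fresh item, not in $G$) otherwise; $\mu^{\uparrow}(R_\mu)$ is the graph with vertices $\mu(V_{R_\mu}\cap V_{K_\mu})\cup((V_{R_\mu}\setminus V_{K_\mu})\times\{\mu\})$, arrows defined similarly, source $\mu^{\uparrow}\circ s_{R_\mu}\circ(\mu^{\uparrow})^{ -1}$, target likewise, algebra $\mathcal{A}_G$, attribution $\mu_{\mathcal{A}}\circ l_{R_\mu}\circ(\mu^{\uparrow})^{ -1}$. For $M\subseteq\mathrm{Match}_{\mathcal{R}}(G)$ let $V^-_M=\bigcup_{\mu\in M}\mu(V_{L_\mu}\setminus V_{K_\mu})$, $A^-_M=\bigcup_{\mu\in M}\mu(A_{L_\mu}\setminus A_{K_\mu})$, $l^-_M(x)=\bigcup\{\mu_{\mathcal{A}}(l_{L_\mu}(y)\setminus l_{K_\mu}(y)) : \mu\in M,\ \mu(y)=x\}$, $l^+_M(x)=\bigcup\{\mu_{\mathcal{A}}(l_{R_\mu}(y)\setminus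 l_{K_\mu}(y)) : \mu\in M,\ \mu(y)=x\}$ (with $l_{R_\mu}(y)=\varnothing$ if $y\notin R_\mu$), and $G_M=\big(G\setminus(V^-_M,A^-_M,l^-_M)\big)\sqcup\bigsqcup_{\mu\in M}\mu^{\uparrow}(R_\mu)$. $M$ is parallel coherent if $\nu(R_\nu\sqcap K_\nu)\sqcap\mu(L_\mu)\lhd\mu(K_\mu)$ for all $\mu,\nu\in M$. $M$ has the effective deletion property if $G_M$ is disjoint from $V^-_M,A^-_M,l^-_M\setminus l^+_M$. -}

module Defs where

open import Data.List using (List; length; lookup)
open import Data.List.Membership.Propositional using (_∈_)
open import Data.Fin using (Fin)
open import Data.Product using (Σ; ∃; _×_; _,_; proj₁; proj₂)
open import Data.Sum using (_⊎_; inj₁; inj₂)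
open import Data.Empty using (⊥)
open import Relation.Nullary using (¬_)
open import Relation.Binary.PropositionalEquality using (_≡_)
open import Function.Bundles using (_⇔_)

record Signature : Set₁ where
  field
    Sort  : Set
    Op    : Set
    arity : Op → List Sort
    res   : Op → Sort

-- Everything below is relative to a fixed signature Σ (here 𝔖), a set
-- 𝒱 of sorted variables (Var, vsort) and a set Item from which the
-- vertices/arrows of rule graphs are drawn.

module Graphs (𝔖 : Signature) (Var : Set) (vsort : Var → Signature.Sort 𝔖)
              (Item : Set) where

  open Signature 𝔖

  Args : (Sort → Set) → Op → Set
  Args C f = (i : Fin (length (arity f))) → C (lookup (arity f) i)

  record Algebra : Set₁ where
    field
      Carrier : Sort → Set
      apply   : (f : Op) → Args Carrier f → Carrier (res f)

  open Algebra

  ∣_∣ : Algebra → Set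
  ∣ 𝒜 ∣ = Σ Sort (Carrier 𝒜)

  SMap : Algebra → Algebra → Set
  SMap 𝒜 𝒞 = (σ : Sort) → Carrier 𝒜 σ → Carrier 𝒞 σ

  IsHom : (𝒜 𝒞 : Algebra) → SMap 𝒜 𝒞 → Set
  IsHom 𝒜 𝒞 h = ∀ f (as : Args (Carrier 𝒜) f) →
    h (res f) (apply 𝒜 f as) ≡ apply 𝒞 f (λ i → h _ (as i))

  ∣_∣ₕ : {𝒜 𝒞 : Algebra} → SMap 𝒜 𝒞 → ∣ 𝒜 ∣ → ∣ 𝒞 ∣
  ∣ h ∣ₕ (σ , a) = σ , h σ a

  Img : {P Q : Set} → (P → Q) → (P → Set) → Q → Set
  Img h S b = ∃ λ c → S c × h c ≡ b

  data Term (X : Var → Set) : Sort → Set where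
    var : (x : Var) → .(X x) → Term X (vsort x)
    app : (f : Op) → ((i : Fin (length (arity f))) → Term X (lookup (arity f) i))
        → Term X (res f)

  data _occursIn_ {X : Var → Set} (x : Var) : {σ : Sort} → Term X σ → Set where
    here  : .{p : X x} → x occursIn var x p
    there : ∀ {f as} (i : Fin (length (arity f))) → x occursIn as i → x occursIn app f as

  TermAlg : (Var → Set) → Algebra
  TermAlg X = record { Carrier = Term X ; apply = app }

  Finite : {P : Set} → (P → Set) → Set
  Finite {P} S = ∃ λ (xs : List P) → ∀ x → S x → x ∈ xs

  -- (Pre)graphs over a universe U of items with algebra 𝒜.
  -- Sets are predicates on U; source/target maps are given by their
  -- graphs (relations), attribution l : U → 𝒫(|𝒜|).

  record PreGraph (U : Set) (𝒜 : Algebra) : Set₁ where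
    field
      V A     : U → Set
      src tgt : U → U → Set
      att     : U → ∣ 𝒜 ∣ → Set

  open PreGraph

  Item? : {U : Set} {𝒜 : Algebra} → PreGraph U 𝒜 → U → Set
  Item? G x = V G x ⊎ A G x

  record IsGraph {U : Set} {𝒜 : Algebra} (G : PreGraph U 𝒜) : Set where
    field
      VA-disj : ∀ x → V G x → A G x → ⊥
      src-tot : ∀ a → A G a → ∃ λ v → src G a v
      src-fun : ∀ a v w → src G a v → src G a w → v ≡ w
      src-dom : ∀ a v → src G a v → A G a × V G v
      tgt-tot : ∀ a → A G a → ∃ λ v → tgt G a v
      tgt-fun : ∀ a v w → tgt G a v → tgt G a w → v ≡ w
      tgt-dom : ∀ a v → tgt G a v → A G a × V G v
      att-dom : ∀ x b → att G x b → Item? G x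

  IsFinGraph : {U : Set} {𝒜 : Algebra} → PreGraph U 𝒜 → Set
  IsFinGraph G = IsGraph G × Finite (V G) × Finite (A G)

  module _ {U : Set} {𝒜 : Algebra} where

    record _⊲_ (H G : PreGraph U 𝒜) : Set where
      field
        V⊆   : ∀ x → V H x → V G x
        A⊆   : ∀ a → A H a → A G a
        src≡ : ∀ a v → A H a → (src H a v ⇔ src G a v)
        tgt≡ : ∀ a v → A H a → (tgt H a v ⇔ tgt G a v)
        att⊆ : ∀ x b → att H x b → att G x b

    record Joinable (H G : PreGraph U 𝒜) : Set where
      field
        VA : ∀ x → V H x → A G x → ⊥
        AV : ∀ x → A H x → V G x → ⊥
        src≡ : ∀ a v → A H a → A G a → (src H a v ⇔ src G a v)
        tgt≡ : ∀ a v → A H a → A G a → (tgt H a v ⇔ tgt G a v)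

    _⊓_ : PreGraph U 𝒜 → PreGraph U 𝒜 → PreGraph U 𝒜
    H ⊓ G = record
      { V   = λ x → V H x × V G x
      ; A   = λ a → A H a × A G a
      ; src = λ a v → (A H a × A G a) × src H a v × src G a v
      ; tgt = λ a v → (A H a × A G a) × tgt H a v × tgt G a v
      ; att = λ x b → att H x b × att G x b }

    _⊔_ : PreGraph U 𝒜 → PreGraph U 𝒜 → PreGraph U 𝒜
    H ⊔ G = record
      { V   = λ x → V H x ⊎ V G x
      ; A   = λ a → A H a ⊎ A G a
      ; src = λ a v → src H a v ⊎ src G a v
      ; tgt = λ a v → tgt H a v ⊎ tgt G a v
      ; att = λ x b → att H x b ⊎ att G x b }

    ⨆ : {I : Set} → (I → PreGraph U 𝒜) → PreGraph U 𝒜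
    ⨆ F = record
      { V   = λ x → ∃ λ i → V (F i) x
      ; A   = λ a → ∃ λ i → A (F i) a
      ; src = λ a v → ∃ λ i → src (F i) a v
      ; tgt = λ a v → ∃ λ i → tgt (F i) a v
      ; att = λ x b → ∃ λ i → att (F i) x b }

    record Disjoint (G : PreGraph U 𝒜) (Vr Ar : U → Set) (lr : U → ∣ 𝒜 ∣ → Set) : Set where
      field
        V-disj : ∀ x → V G x → ¬ Vr x
        A-disj : ∀ a → A G a → ¬ Ar a
        l-disj : ∀ x → Item? G x → ∀ b → att G x b → ¬ lr x b

    -- G ∖ (V, A, l): the largest subgraph of G disjoint from V, A, l
    -- (written out explicitly: arrows whose source or target is removed
    -- are removed as well)
    _∖⟨_,_,_⟩ : PreGraph U 𝒜 → (U → Set) → (U → Set) → (U → ∣ 𝒜 ∣ → Set) → PreGraph U 𝒜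
    G ∖⟨ Vr , Ar , lr ⟩ = record
      { V   = V'
      ; A   = A'
      ; src = λ a v → A' a × src G a v
      ; tgt = λ a v → A' a × tgt G a v
      ; att = λ x b → (V' x ⊎ A' x) × att G x b × ¬ lr x b }
      where
        V' : U → Set
        V' x = V G x × ¬ Vr x
        A' : U → Set
        A' a = A G a × ¬ Ar a × (∀ v → src G a v → ¬ Vr v) × (∀ v → tgt G a v → ¬ Vr v)

  image : {U₁ U₂ : Set} {𝒜₁ 𝒜₂ : Algebra} → (U₁ → U₂) → (∣ 𝒜₁ ∣ → ∣ 𝒜₂ ∣)
        → PreGraph U₁ 𝒜₁ → PreGraph U₂ 𝒜₂
  image f h F = record
    { V   = λ y → ∃ λ x → V F x × f x ≡ y
    ; A   = λ y → ∃ λ x → A F x × f x ≡ y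
    ; src = λ a' v' → ∃ λ a → ∃ λ v → A F a × src F a v × f a ≡ a' × f v ≡ v'
    ; tgt = λ a' v' → ∃ λ a → ∃ λ v → A F a × tgt F a v × f a ≡ a' × f v ≡ v'
    ; att = λ y b → ∃ λ x → ∃ λ c → att F x c × f x ≡ y × h c ≡ b }

  record Morphism {U₁ U₂ : Set} {𝒜₁ 𝒜₂ : Algebra}
                  (H : PreGraph U₁ 𝒜₁) (G : PreGraph U₂ 𝒜₂) : Set where
    field
      map    : U₁ → U₂
      hom    : SMap 𝒜₁ 𝒜₂
      isHom  : IsHom 𝒜₁ 𝒜₂ hom
      V-pres : ∀ x → V H x → V G (map x)
      A-pres : ∀ a → A H a → A G (map a)
      src-pres : ∀ a v → A H a → src H a v → src G (map a) (map v)
      tgt-pres : ∀ a v → A H a → tgt H a v → tgt G (map a) (map v)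
      att-pres : ∀ x b → att H x b → att G (map x) (∣_∣ₕ {𝒜₁} {𝒜₂} hom b)

  record Matching {U₁ U₂ : Set} {𝒜₁ 𝒜₂ : Algebra}
                  (H : PreGraph U₁ 𝒜₁) (G : PreGraph U₂ 𝒜₂) : Set where
    field
      mor : Morphism H G
      inj : ∀ x y → Item? H x → Item? H y → Morphism.map mor x ≡ Morphism.map mor y → x ≡ y

  record Rule : Set₁ where
    field
      X     : Var → Set
      X-fin : Finite X
      L K R : PreGraph Item (TermAlg X)
      L-fg  : IsFinGraph L
      K-fg  : IsFinGraph K
      R-fg  : IsFinGraph R
      LR-joinable : Joinable L R
      L⊓R⊲K : (L ⊓ R) ⊲ K
      K⊲L   : K ⊲ L
      X-vars : ∀ x → (X x ⇔ (∃ λ y → ∃ λ (b : ∣ TermAlg X ∣) → att L y b × x occursIn proj₂ b))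

  DistinctLHS : {n : _} → (Fin n → Rule) → Set
  DistinctLHS ℛ = ∀ i j → ¬ i ≡ j →
    ¬ (∀ x → Item? (Rule.L (ℛ i)) x ⇔ Item? (Rule.L (ℛ j)) x)

  record MatchOf (r : Rule) {U : Set} {𝒜 : Algebra} (G : PreGraph U 𝒜) : Set where
    open Rule r
    field
      mat : Matching L G
    h : ∣ TermAlg X ∣ → ∣ 𝒜 ∣
    h = ∣_∣ₕ {TermAlg X} {𝒜} (Morphism.hom (Matching.mor mat))
    field
      consistent : ∀ x → Item? K x → ∀ b →
        ¬ (Img h (λ c → att L x c × ¬ att K x c) b × Img h (att K x) b)

  module _ {n : _} (ℛ : Fin n → Rule) {U : Set} {𝒜 : Algebra} (G : PreGraph U 𝒜) where

    Match : Set
    Match = Σ (Fin n) λ i → MatchOf (ℛ i) G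

    ruleOf : Match → Rule
    ruleOf μ = ℛ (proj₁ μ)

    Lμ Kμ Rμ : (μ : Match) → PreGraph Item (TermAlg (Rule.X (ruleOf μ)))
    Lμ μ = Rule.L (ruleOf μ)
    Kμ μ = Rule.K (ruleOf μ)
    Rμ μ = Rule.R (ruleOf μ)

    fμ : Match → Item → U
    fμ μ = Morphism.map (Matching.mor (MatchOf.mat (proj₂ μ)))

    hμ : (μ : Match) → ∣ TermAlg (Rule.X (ruleOf μ)) ∣ → ∣ 𝒜 ∣
    hμ μ = MatchOf.h (proj₂ μ)

    img : (μ : Match) → PreGraph Item (TermAlg (Rule.X (ruleOf μ))) → PreGraph U 𝒜
    img μ = image (fμ μ) (hμ μ)

    V⁻ A⁻ : (Match → Set) → U → Set
    V⁻ M x = ∃ λ μ → M μ × ∃ λ y → V (Lμ μ) y × ¬ V (Kμ μ) y × fμ μ y ≡ x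
    A⁻ M x = ∃ λ μ → M μ × ∃ λ y → A (Lμ μ) y × ¬ A (Kμ μ) y × fμ μ y ≡ x

    l⁻ l⁺ : (Match → Set) → U → ∣ 𝒜 ∣ → Set
    l⁻ M x b = ∃ λ μ → M μ × ∃ λ y → Item? (Lμ μ) y × fμ μ y ≡ x ×
      Img (hμ μ) (λ c → att (Lμ μ) y c × ¬ att (Kμ μ) y c) b
    l⁺ M x b = ∃ λ μ → M μ × ∃ λ y → Item? (Lμ μ) y × fμ μ y ≡ x ×
      Img (hμ μ) (λ c → att (Rμ μ) y c × ¬ att (Kμ μ) y c) b

    -- universe of G_M: items of G plus fresh items (x, μ)
    W : Set
    W = U ⊎ (Item × Match)

    Emb : (U → Set) → W → Set
    Emb P (inj₁ x) = P x
    Emb P (inj₂ _) = ⊥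

    Emb₂ : (U → U → Set) → W → W → Set
    Emb₂ P (inj₁ x) (inj₁ y) = P x y
    Emb₂ P _ _ = ⊥

    EmbA : (U → ∣ 𝒜 ∣ → Set) → W → ∣ 𝒜 ∣ → Set
    EmbA P (inj₁ x) b = P x b
    EmbA P (inj₂ _) b = ⊥

    liftG : PreGraph U 𝒜 → PreGraph W 𝒜
    liftG H = record
      { V = Emb (V H) ; A = Emb (A H) ; src = Emb₂ (src H) ; tgt = Emb₂ (tgt H)
      ; att = EmbA (att H) }

    Up : (μ : Match) → Item → W → Set
    Up μ y w = (Item? (Kμ μ) y × w ≡ inj₁ (fμ μ y))
             ⊎ (¬ Item? (Kμ μ) y × w ≡ inj₂ (y , μ))

    up : Match → PreGraph W 𝒜
    up μ = record
      { V = λ w → (∃ λ y → V (Rμ μ) y × V (Kμ μ) y × w ≡ inj₁ (fμ μ y))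
                ⊎ (∃ λ y → V (Rμ μ) y × ¬ V (Kμ μ) y × w ≡ inj₂ (y , μ))
      ; A = λ w → (∃ λ y → A (Rμ μ) y × A (Kμ μ) y × w ≡ inj₁ (fμ μ y))
                ⊎ (∃ λ y → A (Rμ μ) y × ¬ A (Kμ μ) y × w ≡ inj₂ (y , μ))
      ; src = λ w w' → ∃ λ a → ∃ λ v → A (Rμ μ) a × src (Rμ μ) a v × Up μ a w × Up μ v w'
      ; tgt = λ w w' → ∃ λ a → ∃ λ v → A (Rμ μ) a × tgt (Rμ μ) a v × Up μ a w × Up μ v w'
      ; att = λ w b → ∃ λ y → ∃ λ c → att (Rμ μ) y c × Up μ y w × hμ μ c ≡ b }

    G[_] : (Match → Set) → PreGraph W 𝒜
    G[ M ] = liftG (G ∖⟨ V⁻ M , A⁻ M , l⁻ M ⟩) ⊔ ⨆ {I = Σ Match M} (λ μm → up (proj₁ μm))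

    ParallelCoherent : (Match → Set) → Set
    ParallelCoherent M = ∀ μ ν → M μ → M ν →
      (img ν (Rμ ν ⊓ Kμ ν) ⊓ img μ (Lμ μ)) ⊲ img μ (Kμ μ)

    EffectiveDeletion : (Match → Set) → Set
    EffectiveDeletion M =
      Disjoint G[ M ] (Emb (V⁻ M)) (Emb (A⁻ M)) (EmbA (λ x b → l⁻ M x b × ¬ l⁺ M x b))

-- If μ ∈ M keeps an item (it lies in R_μ ⊓ K_μ) and ν ∈ M matches it by some
-- item of L_ν, parallel coherence puts its image into ν(K_ν); injectivity of ν
-- makes the two preimages equal, so ν does not delete it (for attributes, this
-- contradicts consistency of ν). Every other item of G_M is either a survivor of
-- G ∖ (V⁻, A⁻, l⁻) or fresh, and attributes that μ adds lie in l⁺.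
module Submission where

open import Defs
open import Data.Fin using (Fin)
open import Data.Product using (_×_; _,_; proj₁; proj₂)
open import Data.Sum using (inj₁; inj₂)
open import Data.Empty using (⊥)
open import Relation.Nullary using (¬_)
open import Relation.Binary.PropositionalEquality using (_≡_; refl; sym; trans)

module _ (𝔖 : Signature) (Var : Set) (vsort : Var → Signature.Sort 𝔖) (Item : Set) where
  open Graphs 𝔖 Var vsort Item
  open PreGraph

  module _ {U₁ U : Set} {𝒜₁ 𝒜 : Algebra} {L K : PreGraph U₁ 𝒜₁} {G : PreGraph U 𝒜}
           (K⊲L : K ⊲ L) (m : Matching L G) where
    private
      f : U₁ → U
      f = Morphism.map (Matching.mor m)

    ⊲-item : ∀ {z} → Item? K z → Item? L z
    ⊲-item (inj₁ v) = inj₁ (_⊲_.V⊆ K⊲L _ v)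
    ⊲-item (inj₂ a) = inj₂ (_⊲_.A⊆ K⊲L _ a)

    matching-reflects-V : ∀ {y z} → V K z → Item? L y → f z ≡ f y → V K y
    matching-reflects-V {y} {z} vz iy eq with Matching.inj m z y (⊲-item (inj₁ vz)) iy eq
    ... | refl = vz

    matching-reflects-A : ∀ {y z} → A K z → Item? L y → f z ≡ f y → A K y
    matching-reflects-A {y} {z} az iy eq with Matching.inj m z y (⊲-item (inj₂ az)) iy eq
    ... | refl = az

  module _ (r : Rule) {U : Set} {𝒜 : Algebra} {G : PreGraph U 𝒜} (ν : MatchOf r G) where
    open Rule r
    open MatchOf ν

    kept-and-deleted-attributes-differ : ∀ {y z c b} → att K z c → Item? L y →
      Morphism.map (Matching.mor mat) z ≡ Morphism.map (Matching.mor mat) y →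
      Img h (λ c′ → att L y c′ × ¬ att K y c′) b → h c ≡ b → ⊥
    kept-and-deleted-attributes-differ ac iy eq deleted hc with IsGraph.att-dom (proj₁ K-fg) _ _ ac
    ... | iKz with Matching.inj mat _ _ (⊲-item K⊲L mat iKz) iy eq
    ... | refl = consistent _ iKz _ (deleted , (_ , ac , hc))

  module _ {n : _} (ℛ : Fin n → Rule) {U : Set} {𝒜 : Algebra} (G : PreGraph U 𝒜)
           (M : Match ℛ G → Set) (coherent : ParallelCoherent ℛ G M) where

    private
      K⊲Lμ : (μ : Match ℛ G) → Kμ ℛ G μ ⊲ Lμ ℛ G μ
      K⊲Lμ μ = Rule.K⊲L (ruleOf ℛ G μ)

      matμ : (μ : Match ℛ G) → Matching (Lμ ℛ G μ) G
      matμ μ = MatchOf.mat (proj₂ μ)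

    kept-vertex∉V⁻ : ∀ {μ y} → M μ → V (Rμ ℛ G μ) y → V (Kμ ℛ G μ) y →
      ¬ V⁻ ℛ G M (fμ ℛ G μ y)
    kept-vertex∉V⁻ {μ} {y} mμ vR vK (ν , mν , y′ , vL , ¬vK , eq)
      with _⊲_.V⊆ (coherent ν μ mν mμ) _ ((y , (vR , vK) , refl) , (y′ , vL , eq))
    ... | _ , vKz , ez =
      ¬vK (matching-reflects-V (K⊲Lμ ν) (matμ ν) vKz (inj₁ vL) (trans ez (sym eq)))

    kept-arrow∉A⁻ : ∀ {μ y} → M μ → A (Rμ ℛ G μ) y → A (Kμ ℛ G μ) y →
      ¬ A⁻ ℛ G M (fμ ℛ G μ y)
    kept-arrow∉A⁻ {μ} {y} mμ aR aK (ν , mν , y′ , aL , ¬aK , eq)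
      with _⊲_.A⊆ (coherent ν μ mν mμ) _ ((y , (aR , aK) , refl) , (y′ , aL , eq))
    ... | _ , aKz , ez =
      ¬aK (matching-reflects-A (K⊲Lμ ν) (matμ ν) aKz (inj₂ aL) (trans ez (sym eq)))

    kept-attribute∉l⁻ : ∀ {μ y c} → M μ → att (Rμ ℛ G μ) y c → att (Kμ ℛ G μ) y c →
      ¬ l⁻ ℛ G M (fμ ℛ G μ y) (hμ ℛ G μ c)
    kept-attribute∉l⁻ {μ} {y} {c} mμ aR aK (ν , mν , y′ , iL , eq , deleted@(c′ , delL , hc′))
      with _⊲_.att⊆ (coherent ν μ mν mμ) _ _
             ((y , c , (aR , aK) , refl , refl) , (y′ , c′ , proj₁ delL , eq , hc′))
    ... | _ , _ , aKz , ez , hz =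
      kept-and-deleted-attributes-differ (ruleOf ℛ G ν) (proj₂ ν) aKz iL (trans ez (sym eq)) deleted hz

    effective-deletion : EffectiveDeletion ℛ G M
    effective-deletion = record { V-disj = V-disj ; A-disj = A-disj ; l-disj = l-disj }
      where
        V-disj : ∀ w → V (G[_] ℛ G M) w → ¬ Emb ℛ G (V⁻ ℛ G M) w
        V-disj (inj₁ _) (inj₁ (_ , ¬V⁻)) = ¬V⁻
        V-disj (inj₂ _) (inj₁ ())
        V-disj _ (inj₂ ((_ , mμ) , inj₁ (_ , vR , vK , refl))) = kept-vertex∉V⁻ mμ vR vK
        V-disj _ (inj₂ (_ , inj₂ (_ , _ , _ , refl))) ()

        A-disj : ∀ w → A (G[_] ℛ G M) w → ¬ Emb ℛ G (A⁻ ℛ G M) w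
        A-disj (inj₁ _) (inj₁ (_ , ¬A⁻ , _)) = ¬A⁻
        A-disj (inj₂ _) (inj₁ ())
        A-disj _ (inj₂ ((_ , mμ) , inj₁ (_ , aR , aK , refl))) = kept-arrow∉A⁻ mμ aR aK
        A-disj _ (inj₂ (_ , inj₂ (_ , _ , _ , refl))) ()

        l-disj : ∀ w → Item? (G[_] ℛ G M) w → ∀ b → att (G[_] ℛ G M) w b →
          ¬ EmbA ℛ G (λ x b → l⁻ ℛ G M x b × ¬ l⁺ ℛ G M x b) w b
        l-disj (inj₁ _) _ _ (inj₁ (_ , _ , ¬l⁻)) (l⁻ , _) = ¬l⁻ l⁻
        l-disj (inj₂ _) _ _ (inj₁ ())
        l-disj _ _ _ (inj₂ (_ , _ , _ , _ , inj₂ (_ , refl) , _)) ()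
        -- c ∉ l_K(y) is obtained by refuting c ∈ l_K(y): no decidability of attributes is needed.
        l-disj _ _ _ (inj₂ ((μ , mμ) , y , c , aR , inj₁ (iK , refl) , refl)) (deleted , ¬l⁺) =
          ¬l⁺ (μ , mμ , y , ⊲-item (K⊲Lμ μ) (matμ μ) iK , refl ,
               c , (aR , λ aK → kept-attribute∉l⁻ mμ aR aK deleted) , refl)

theorem3 : (𝔖 : Signature) (Var : Set) (vsort : Var → Signature.Sort 𝔖) (Item : Set) →
    let open Graphs 𝔖 Var vsort Item in
    {n : _} (ℛ : Fin n → Rule) → DistinctLHS ℛ →
    {U : Set} {𝒜 : Algebra} (G : PreGraph U 𝒜) → IsGraph G →
    (M : Match ℛ G → Set) →
    ParallelCoherent ℛ G M → EffectiveDeletion ℛ G M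
theorem3 𝔖 Var vsort Item ℛ _ G _ M = effective-deletion 𝔖 Var vsort Item ℛ G M
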